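{- Let $s \geq 1$ be an integer and, for $n \geq 0$, let $g(n)$ denote the number of linear extensions of the uneven type-$\alpha$ comb $\alpha^{\ast}_{s}(n)$ that avoid both patterns $312$ and $321$. Then $$g(n) = \begin{cases} 1 & \text{if } n \leq s,\\ 2^{n-s} & \text{if } s < n < 2s,\\ 2g(n-1) - g(n-s-1) & \text{if } n \geq 2s.\end{cases}$$
   Context: A linear extension of a finite poset $P$ on a set of integers is a listing $v=[v_1,\dots,v_n]$ of all elements of $P$, each exactly once, such that whenever $a \leq_P b$, $a$ appears before $b$. For $w \in S_3$, a sequence $v$ of distinct integers contains $w$ if there are indices $i<j<k$ with $(v_i,v_j,v_k)$ in the same relative order as $(w_1,w_2,w_3)$; otherwise $v$ avoids $w$. The uneven type-$\alpha$ comb $\alpha^{\ast}_{s}(n)$ with $s$ teeth and $n$ elements is the poset on $\{1,\dots,n\}$ whose order is generated by the relations $i \leq i+1$ for $1 \leq i < \min(s,n)$ (the spine) and $x \leq x+s$ for $1 \leq x \leq n-s$ (the teeth $c, c+s, c+2s, \dots$ for $1 \le c \le s$, truncated at $n$). When $n = ts$, this is the type-$\alpha$ comb with $s$ teeth of length $t$. -}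

module Defs where

open import Data.Nat using (ℕ; zero; suc; _+_; _<_; _≤_; _⊔_; _⊓_)
open import Data.Fin using (Fin; toℕ)
open import Data.List using (List; length; lookup; applyUpTo)
open import Data.List.Membership.Propositional using (_∈_)
open import Data.List.Relation.Unary.Unique.Propositional using (Unique)
open import Data.List.Relation.Binary.Permutation.Propositional using (_↭_)
open import Data.Product using (Σ; ∃; _×_; _,_)
open import Data.Sum using (_⊎_)
open import Relation.Nullary using (¬_)
open import Relation.Binary.PropositionalEquality using (_≡_)
open import Relation.Binary.Construct.Closure.ReflexiveTransitive using (Star)
open import Function.Bundles using (_⇔_)

data CombGen (s n : ℕ) : ℕ → ℕ → Set where
  spine : ∀ {i} → 1 ≤ i → i < s ⊓ n → CombGen s n i (suc i)
  tooth : ∀ {x} → 1 ≤ x → x + s ≤ n → CombGen s n x (x + s)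

CombLeq : ℕ → ℕ → ℕ → ℕ → Set
CombLeq s n = Star (CombGen s n)

ground : ℕ → List ℕ
ground n = applyUpTo suc n

IsLinExt : ℕ → ℕ → List ℕ → Set
IsLinExt s n v =
  (v ↭ ground n) ×
  (∀ (i j : Fin (length v)) → CombLeq s n (lookup v i) (lookup v j) → toℕ i ≤ toℕ j)

SameOrder : ℕ → ℕ → ℕ → ℕ → ℕ → ℕ → Set
SameOrder a b c w₁ w₂ w₃ =
  ((a < b) ⇔ (w₁ < w₂)) × ((a < c) ⇔ (w₁ < w₃)) × ((b < c) ⇔ (w₂ < w₃))

Contains : ℕ → ℕ → ℕ → List ℕ → Set
Contains w₁ w₂ w₃ v =
  Σ (Fin (length v)) λ i → Σ (Fin (length v)) λ j → Σ (Fin (length v)) λ k →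
    (toℕ i < toℕ j) × (toℕ j < toℕ k) ×
    SameOrder (lookup v i) (lookup v j) (lookup v k) w₁ w₂ w₃

Avoids : ℕ → ℕ → ℕ → List ℕ → Set
Avoids w₁ w₂ w₃ v = ¬ Contains w₁ w₂ w₃ v

Good : ℕ → ℕ → List ℕ → Set
Good s n v = IsLinExt s n v × Avoids 3 1 2 v × Avoids 3 2 1 v

-- "Exactly k lists satisfy P": a duplicate-free list enumerating exactly the
-- lists satisfying P, of length k.
HasCount : (List ℕ → Set) → ℕ → Set
HasCount P k =
  Σ (List (List ℕ)) λ L → Unique L × (∀ v → (v ∈ L) ⇔ P v) × (length L ≡ k)

-- A list avoids 312 and 321 exactly when no entry is followed by two entries
-- below it, i.e. when every entry is the least or the second least of the
-- entries not yet listed.  Reading a good linear extension from the left,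
-- the least remaining element k is therefore either placed at once or
-- postponed while its successors k+1, k+2, … are placed.  On the spine
-- (k < s) the relation k ≤ k+1 forbids postponing; beyond it only the tooth
-- k ≤ k+s constrains k, so at most s-1 elements may precede it.  Hence,
-- after the forced first s-1 entries, the number fib R of good arrangements
-- of R remaining elements satisfies fib (R+1) = fib R + ⋯ + fib (R+1-s),
-- an s-step Fibonacci recurrence, and g n = fib (n - s + 1).

module Submission where

open import Defs
open import Data.Nat using (ℕ; zero; suc; pred; _+_; _*_; _∸_; _^_; _≤_; _<_; z≤n; s≤s; z<s; s≤s⁻¹; _≤?_; _<?_; _≟_)
open import Data.Nat.Properties
open import Data.Nat.Tactic.RingSolver using (solve-∀)
open import Data.Fin using (Fin; toℕ) renaming (zero to fzero; suc to fsuc)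
open import Data.Fin.Properties using (toℕ-injective)
open import Data.List using (List; []; _∷_; [_]; _++_; map; length; lookup; applyUpTo)
open import Data.List.Properties using (length-++; length-map; ∷-injectiveˡ; ∷-injectiveʳ)
open import Data.List.Membership.Propositional using (_∈_)
open import Data.List.Membership.Propositional.Properties using (∈-map⁺; ∈-map⁻; ∈-++⁺ˡ; ∈-++⁺ʳ; ∈-++⁻; ∈-lookup)
open import Data.List.Relation.Unary.Any using (here; there; index)
open import Data.List.Relation.Unary.Any.Properties using (lookup-index)
open import Data.List.Relation.Unary.All as All using (All; [])
open import Data.List.Relation.Unary.AllPairs using (AllPairs; []; _∷_)
open import Data.List.Relation.Unary.Unique.Propositional using (Unique)
import Data.List.Relation.Unary.Unique.Propositional.Properties as Unique
open import Data.List.Relation.Binary.Permutation.Propositional using (_↭_; swap; prep; ↭-refl; ↭-trans; ↭-sym; ↭⇒↭ₛ)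
open import Data.List.Relation.Binary.Permutation.Propositional.Properties using (∈-resp-↭; ↭-empty-inv; ¬x∷xs↭[]; drop-∷)
import Data.List.Relation.Binary.Permutation.Setoid.Properties as PermutationSetoid
open import Data.Product using (Σ; ∃; _×_; _,_)
open import Data.Sum using (_⊎_; inj₁; inj₂)
open import Data.Empty using (⊥-elim)
open import Function using (_∘_)
open import Function.Bundles using (_⇔_; mk⇔; Equivalence)
open import Relation.Nullary using (¬_; yes; no)
open import Relation.Nullary.Decidable using (from-yes; from-no)
open import Relation.Binary.Definitions using (tri<; tri≈; tri>)
open import Relation.Binary.PropositionalEquality using (_≡_; _≢_; refl; sym; trans; cong; cong₂; subst; setoid; module ≡-Reasoning)
open import Relation.Binary.Construct.Closure.ReflexiveTransitive using (ε; _◅_)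

∈-tail : ∀ {A : Set} {x y : A} {w} → y ∈ x ∷ w → y ≢ x → y ∈ w
∈-tail (here y≡x) y≢x = ⊥-elim (y≢x y≡x)
∈-tail (there y∈w) _ = y∈w

∈⇒lookup : ∀ {A : Set} {y : A} {w} → y ∈ w → ∃ λ i → lookup w i ≡ y
∈⇒lookup y∈w = index y∈w , sym (lookup-index y∈w)

lookup-injective : ∀ {A : Set} {v : List A} → Unique v → ∀ i j → lookup v i ≡ lookup v j → i ≡ j
lookup-injective (_ ∷ _) fzero fzero _ = refl
lookup-injective (x∉w ∷ _) fzero (fsuc j) x≡wⱼ = ⊥-elim (All.lookup x∉w (∈-lookup j) x≡wⱼ)
lookup-injective (x∉w ∷ _) (fsuc i) fzero wᵢ≡x = ⊥-elim (All.lookup x∉w (∈-lookup i) (sym wᵢ≡x))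
lookup-injective (_ ∷ uniq) (fsuc i) (fsuc j) wᵢ≡wⱼ = cong fsuc (lookup-injective uniq i j wᵢ≡wⱼ)

Unique-resp-↭ : ∀ {A : Set} {v w : List A} → v ↭ w → Unique v → Unique w
Unique-resp-↭ {A} v↭w = PermutationSetoid.Unique-resp-↭ (setoid A) (↭⇒↭ₛ v↭w)

unique-branches : ∀ {A : Set} {a b : A} {xs ys : List (List A)} → a ≢ b → Unique xs → Unique ys →
                  Unique (map (a ∷_) xs ++ map (b ∷_) ys)
unique-branches {a = a} {b} {xs} {ys} a≢b uxs uys =
  Unique.++⁺ (Unique.map⁺ ∷-injectiveʳ uxs) (Unique.map⁺ ∷-injectiveʳ uys) disjoint
  where
  disjoint : ∀ {v} → ¬ (v ∈ map (a ∷_) xs × v ∈ map (b ∷_) ys)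
  disjoint (v∈as , v∈bs) with ∈-map⁻ _ v∈as | ∈-map⁻ _ v∈bs
  ... | _ , _ , refl | _ , _ , a∷≡b∷ = a≢b (∷-injectiveˡ a∷≡b∷)

length-branches : ∀ {A : Set} (a b : A) (xs ys : List (List A)) →
                  length (map (a ∷_) xs ++ map (b ∷_) ys) ≡ length xs + length ys
length-branches a b xs ys =
  trans (length-++ (map (a ∷_) xs)) (cong₂ _+_ (length-map (a ∷_) xs) (length-map (b ∷_) ys))

interval : ℕ → ℕ → List ℕ
interval k zero = []
interval k (suc R) = k ∷ interval (suc k) R

∈-interval⁻ : ∀ {k R y} → y ∈ interval k R → k ≤ y
∈-interval⁻ {R = suc R} (here refl) = ≤-refl
∈-interval⁻ {R = suc R} (there y∈) = <⇒≤ (∈-interval⁻ y∈)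

applyUpTo≡interval : ∀ {f k} R → (∀ i → f i ≡ k + i) → applyUpTo f R ≡ interval k R
applyUpTo≡interval zero _ = refl
applyUpTo≡interval {k = k} (suc R) f≗ =
  cong₂ _∷_ (trans (f≗ 0) (+-identityʳ k)) (applyUpTo≡interval R (λ i → trans (f≗ (suc i)) (+-suc k i)))

ground≡interval : ∀ n → ground n ≡ interval 1 n
ground≡interval n = applyUpTo≡interval n (λ _ → refl)

unique-ground : ∀ n → Unique (ground n)
unique-ground n = Unique.applyUpTo⁺₁ suc n (λ i<j _ → <⇒≢ (s≤s i<j))

-- Avoiding 312 and 321

data NoTwoBelow : List ℕ → Set where
  [] : NoTwoBelow []
  _∷_ : ∀ {x w} → (∀ {a b} → a ∈ w → b ∈ w → a ≤ x → b ≤ x → a ≡ b) → NoTwoBelow w → NoTwoBelow (x ∷ w)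

noTwoBelow-lookup : ∀ {v} → NoTwoBelow v → ∀ i j k → toℕ i < toℕ j → toℕ j < toℕ k →
                    lookup v j ≤ lookup v i → lookup v k ≤ lookup v i → lookup v j ≡ lookup v k
noTwoBelow-lookup (below ∷ _) fzero (fsuc j) (fsuc k) _ _ = below (∈-lookup j) (∈-lookup k)
noTwoBelow-lookup (_ ∷ ntb) (fsuc i) (fsuc j) (fsuc k) (s≤s i<j) (s≤s j<k) = noTwoBelow-lookup ntb i j k i<j j<k

noTwoBelow⇒avoids : ∀ {w₂ w₃ v} → w₂ < 3 → w₃ < 3 → Unique v → NoTwoBelow v → Avoids 3 w₂ w₃ v
noTwoBelow⇒avoids w₂<3 w₃<3 uniq ntb (i , j , k , i<j , j<k , vᵢ<vⱼ⇔ , vᵢ<vₖ⇔ , _) =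
  <⇒≢ j<k (cong toℕ (lookup-injective uniq j k
    (noTwoBelow-lookup ntb i j k i<j j<k (not-above vᵢ<vⱼ⇔ w₂<3) (not-above vᵢ<vₖ⇔ w₃<3))))
  where
  not-above : ∀ {a b w} → (a < b) ⇔ (3 < w) → w < 3 → b ≤ a
  not-above a<b⇔ w<3 = ≮⇒≥ (λ a<b → <-asym w<3 (Equivalence.to a<b⇔ a<b))

contains-∷ : ∀ {w₁ w₂ w₃ x w} → Contains w₁ w₂ w₃ w → Contains w₁ w₂ w₃ (x ∷ w)
contains-∷ (i , j , k , i<j , j<k , order) = fsuc i , fsuc j , fsuc k , s≤s i<j , s≤s j<k , order

avoids⇒noTwoBelow : ∀ {v} → Avoids 3 1 2 v → Avoids 3 2 1 v → NoTwoBelow v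
avoids⇒noTwoBelow {[]} _ _ = []
avoids⇒noTwoBelow {x ∷ w} av312 av321 =
  two-below-equal ∷ avoids⇒noTwoBelow (av312 ∘ contains-∷) (av321 ∘ contains-∷)
  where
  false⇔ : ∀ {A B : Set} → ¬ A → ¬ B → A ⇔ B
  false⇔ ¬a ¬b = mk⇔ (⊥-elim ∘ ¬a) (⊥-elim ∘ ¬b)

  true⇔ : ∀ {A B : Set} → A → B → A ⇔ B
  true⇔ a b = mk⇔ (λ _ → b) (λ _ → a)

  pair-equal : ∀ i j → toℕ i < toℕ j → lookup w i ≤ x → lookup w j ≤ x → lookup w i ≡ lookup w j
  pair-equal i j i<j wᵢ≤x wⱼ≤x with <-cmp (lookup w i) (lookup w j)
  ... | tri< wᵢ<wⱼ _ _ = ⊥-elim (av312 (fzero , fsuc i , fsuc j , z<s , s≤s i<j ,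
          false⇔ (≤⇒≯ wᵢ≤x) (from-no (3 <? 1)) , false⇔ (≤⇒≯ wⱼ≤x) (from-no (3 <? 2)) ,
          true⇔ wᵢ<wⱼ (from-yes (1 <? 2))))
  ... | tri≈ _ wᵢ≡wⱼ _ = wᵢ≡wⱼ
  ... | tri> _ _ wⱼ<wᵢ = ⊥-elim (av321 (fzero , fsuc i , fsuc j , z<s , s≤s i<j ,
          false⇔ (≤⇒≯ wᵢ≤x) (from-no (3 <? 2)) , false⇔ (≤⇒≯ wⱼ≤x) (from-no (3 <? 1)) ,
          false⇔ (<⇒≯ wⱼ<wᵢ) (from-no (2 <? 1))))

  two-below-equal : ∀ {a b} → a ∈ w → b ∈ w → a ≤ x → b ≤ x → a ≡ b
  two-below-equal a∈w b∈w a≤x b≤x with ∈⇒lookup a∈w | ∈⇒lookup b∈w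
  ... | i , refl | j , refl with <-cmp (toℕ i) (toℕ j)
  ...   | tri< i<j _ _ = pair-equal i j i<j a≤x b≤x
  ...   | tri≈ _ i≡j _ = cong (lookup w) (toℕ-injective i≡j)
  ...   | tri> _ _ j<i = sym (pair-equal j i j<i b≤x a≤x)

module Comb (s n : ℕ) where

  _≼_ : ℕ → ℕ → Set
  _≼_ = CombLeq s n

  ≼⇒≤ : ∀ {a b} → a ≼ b → a ≤ b
  ≼⇒≤ ε = ≤-refl
  ≼⇒≤ (spine _ _ ◅ a′≼b) = ≤-trans (n≤1+n _) (≼⇒≤ a′≼b)
  ≼⇒≤ (tooth _ _ ◅ a′≼b) = ≤-trans (m≤m+n _ s) (≼⇒≤ a′≼b)

  ≼-off-spine : ∀ {k x} → s ≤ k → k ≼ x → x ≡ k ⊎ k + s ≤ x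
  ≼-off-spine _ ε = inj₁ refl
  ≼-off-spine s≤k (spine _ k<s⊓n ◅ _) = ⊥-elim (<⇒≱ (m<n⊓o⇒m<n s n k<s⊓n) s≤k)
  ≼-off-spine _ (tooth _ _ ◅ k+s≼x) = inj₂ (≼⇒≤ k+s≼x)

  RespectsOrder : List ℕ → Set
  RespectsOrder = AllPairs (λ x y → ¬ y ≼ x)

  respectsOrder⇒positions : ∀ {v} → RespectsOrder v →
                            ∀ (i j : Fin (length v)) → lookup v i ≼ lookup v j → toℕ i ≤ toℕ j
  respectsOrder⇒positions (_ ∷ _) fzero _ _ = z≤n
  respectsOrder⇒positions (x⋡w ∷ _) (fsuc i) fzero wᵢ≼x = ⊥-elim (All.lookup x⋡w (∈-lookup i) wᵢ≼x)
  respectsOrder⇒positions (_ ∷ ro) (fsuc i) (fsuc j) wᵢ≼wⱼ = s≤s (respectsOrder⇒positions ro i j wᵢ≼wⱼ)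

  positions⇒respectsOrder : ∀ {v} → (∀ (i j : Fin (length v)) → lookup v i ≼ lookup v j → toℕ i ≤ toℕ j) →
                            RespectsOrder v
  positions⇒respectsOrder {[]} _ = []
  positions⇒respectsOrder {x ∷ w} ordered =
    All.tabulate (λ y∈w y≼x → later-not-below y∈w y≼x)
      ∷ positions⇒respectsOrder (λ i j wᵢ≼wⱼ → s≤s⁻¹ (ordered (fsuc i) (fsuc j) wᵢ≼wⱼ))
    where
    later-not-below : ∀ {y} → y ∈ w → ¬ y ≼ x
    later-not-below y∈w y≼x with ∈⇒lookup y∈w
    ... | i , refl with ordered (fsuc i) fzero y≼x
    ... | ()

-- The s-step Fibonacci numbers, s = p + 1

module StepFibonacci (p : ℕ) where

  mutual
    fib : ℕ → ℕ
    fib zero = 1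
    fib (suc R) = fibSum p R

    -- fibSum q R = fib R + fib (R ∸ 1) + ⋯ + fib (R ∸ q), stopping at fib 0
    fibSum : ℕ → ℕ → ℕ
    fibSum q R = fib R + fibSumTail q R

    fibSumTail : ℕ → ℕ → ℕ
    fibSumTail (suc q) (suc R) = fibSum q R
    fibSumTail _ _ = 0

  mutual
    fib-pow : ∀ R → R ≤ suc p → fib R ≡ 2 ^ pred R
    fib-pow zero _ = refl
    fib-pow (suc R) (s≤s R≤p) = fibSum-pow p R R≤p ≤-refl

    fibSum-pow : ∀ q R → R ≤ q → q ≤ p → fibSum q R ≡ 2 ^ R
    fibSum-pow zero zero _ _ = refl
    fibSum-pow (suc q) zero _ _ = refl
    fibSum-pow (suc q) (suc R) (s≤s R≤q) q<p = begin
      fib (suc R) + fibSum q R ≡⟨ cong₂ _+_ (fib-pow (suc R) (s≤s (≤-trans R≤q (<⇒≤ q<p))))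
                                              (fibSum-pow q R R≤q (<⇒≤ q<p)) ⟩
      2 ^ R + 2 ^ R            ≡⟨ cong (2 ^ R +_) (sym (+-identityʳ (2 ^ R))) ⟩
      2 ^ suc R                ∎
      where open ≡-Reasoning

  fibSum-suc : ∀ q R → q ≤ R → fibSum q (suc R) + fib (R ∸ q) ≡ fib (suc R) + fibSum q R
  fibSum-suc zero R _ =
    trans (cong (_+ fib R) (+-identityʳ (fib (suc R)))) (cong (fib (suc R) +_) (sym (+-identityʳ (fib R))))
  fibSum-suc (suc q) (suc R) (s≤s q≤R) = begin
    fib (suc (suc R)) + fibSum q (suc R) + fib (R ∸ q)   ≡⟨ +-assoc (fib (suc (suc R))) _ _ ⟩
    fib (suc (suc R)) + (fibSum q (suc R) + fib (R ∸ q)) ≡⟨ cong (fib (suc (suc R)) +_) (fibSum-suc q R q≤R) ⟩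
    fib (suc (suc R)) + (fib (suc R) + fibSum q R)       ∎
    where open ≡-Reasoning

  fib-recurrence : ∀ R → p ≤ R → fib (2 + R) ≡ 2 * fib (1 + R) ∸ fib (R ∸ p)
  fib-recurrence R p≤R = sym (trans (cong (_∸ fib (R ∸ p)) twice) (m+n∸n≡m (fib (2 + R)) (fib (R ∸ p))))
    where
    twice : 2 * fib (1 + R) ≡ fib (2 + R) + fib (R ∸ p)
    twice = begin
      2 * fib (1 + R)                ≡⟨ cong (fib (1 + R) +_) (+-identityʳ (fib (1 + R))) ⟩
      fib (1 + R) + fibSum p R       ≡⟨ sym (fibSum-suc p R p≤R) ⟩
      fib (2 + R) + fib (R ∸ p)      ∎
      where open ≡-Reasoning

  fib-shifted-pow : ∀ n → n < 2 * suc p → fib (n ∸ p) ≡ 2 ^ (n ∸ suc p)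
  fib-shifted-pow n n<2s =
    trans (fib-pow (n ∸ p) (m≤n+o⇒m∸n≤o n p n≤p+s)) (cong (2 ^_) (pred[m∸n]≡m∸[1+n] n p))
    where
    double : ∀ m → 2 * suc m ≡ suc (m + suc m)
    double = solve-∀
    n≤p+s : n ≤ p + suc p
    n≤p+s = s≤s⁻¹ (subst (n <_) (double p) n<2s)

  fib-shifted-recurrence : ∀ n → 2 * suc p ≤ n → fib (n ∸ p) ≡ 2 * fib (n ∸ 1 ∸ p) ∸ fib (n ∸ suc p ∸ 1 ∸ p)
  fib-shifted-recurrence n 2s≤n with m≤n⇒∃[o]m+o≡n 2s≤n
  ... | d , refl = begin
    fib (N ∸ p)                                ≡⟨ cong fib (∸-cancel p (split₁ p d)) ⟩
    fib (2 + (p + d))                          ≡⟨ fib-recurrence (p + d) (m≤m+n p d) ⟩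
    2 * fib (1 + (p + d)) ∸ fib (p + d ∸ p)    ≡⟨ sym (cong₂ (λ a b → 2 * fib a ∸ fib b)
                                                      (∸-cancel p (∸-cancel 1 (split₂ p d)))
                                                      (cong (_∸ p) (∸-cancel 1 (∸-cancel (suc p) (split₃ p d))))) ⟩
    2 * fib (N ∸ 1 ∸ p) ∸ fib (N ∸ suc p ∸ 1 ∸ p) ∎
    where
    open ≡-Reasoning
    N : ℕ
    N = 2 * suc p + d
    ∸-cancel : ∀ {a} b {c} → a ≡ b + c → a ∸ b ≡ c
    ∸-cancel b {c} refl = m+n∸m≡n b c
    split₁ : ∀ m d → 2 * suc m + d ≡ m + (2 + (m + d))
    split₁ = solve-∀
    split₂ : ∀ m d → 2 * suc m + d ≡ 1 + (m + (1 + (m + d)))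
    split₂ = solve-∀
    split₃ : ∀ m d → 2 * suc m + d ≡ suc m + (1 + (m + d))
    split₃ = solve-∀

-- Good arrangements of the comb, s = p + 1

module Arrangements (p : ℕ) where

  private
    s : ℕ
    s = suc p

  budget : ℕ → ℕ
  budget k with s ≤? k
  ... | yes _ = p
  ... | no _ = 0

  budget-off-spine : ∀ {k} → s ≤ k → budget k ≡ p
  budget-off-spine {k} s≤k with s ≤? k
  ... | yes _ = refl
  ... | no s≰k = ⊥-elim (s≰k s≤k)

  budget-on-spine : ∀ {k} → k < s → budget k ≡ 0
  budget-on-spine {k} k<s with s ≤? k
  ... | yes s≤k = ⊥-elim (<⇒≱ k<s s≤k)
  ... | no _ = refl

  -- Window k q c: k is pending, c is the least element above k not yet
  -- placed, and q more elements may still be placed before k.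
  data Window (k : ℕ) : ℕ → ℕ → Set where
    offSpine : ∀ {q c} → s ≤ k → k < c → c + q ≡ k + s → Window k q c
    onSpine : k < s → Window k 0 (suc k)

  window-start : ∀ k → Window k (budget k) (suc k)
  window-start k with s ≤? k
  ... | yes s≤k = offSpine s≤k ≤-refl (sym (+-suc k p))
  ... | no s≰k = onSpine (≰⇒> s≰k)

  window-< : ∀ {k q c} → Window k q c → k < c
  window-< (offSpine _ k<c _) = k<c
  window-< (onSpine _) = ≤-refl

  window-step : ∀ {k q c} → Window k (suc q) c → Window k q (suc c)
  window-step {q = q} {c} (offSpine s≤k k<c c+q≡) = offSpine s≤k (m<n⇒m<1+n k<c) (trans (sym (+-suc c q)) c+q≡)

  -- Fresh k R w: w is a good arrangement of [k, k + R).
  -- Pending k q c R w: w is a good arrangement of {k} ∪ [c, c + R) in which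
  -- the least element k may still be preceded by q further elements.
  mutual
    data Fresh : ℕ → ℕ → List ℕ → Set where
      done : ∀ {k} → Fresh k 0 []
      next : ∀ {k R w} → Pending k (budget k) (suc k) R w → Fresh k (suc R) w

    data Pending (k : ℕ) : ℕ → ℕ → ℕ → List ℕ → Set where
      placeMin : ∀ {q c R w} → Fresh c R w → Pending k q c R (k ∷ w)
      defer : ∀ {q c R w} → Pending k q (suc c) R w → Pending k (suc q) c (suc R) (c ∷ w)

  mutual
    fresh : ℕ → ℕ → List (List ℕ)
    fresh k zero = [ [] ]
    fresh k (suc R) = pending k (budget k) (suc k) R

    pending : ℕ → ℕ → ℕ → ℕ → List (List ℕ)
    pending k q c R = map (k ∷_) (fresh c R) ++ map (c ∷_) (deferred k q c R)

    deferred : ℕ → ℕ → ℕ → ℕ → List (List ℕ)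
    deferred k (suc q) c (suc R) = pending k q (suc c) R
    deferred _ _ _ _ = []

  mutual
    ∈-fresh⁻ : ∀ {k R v} → v ∈ fresh k R → Fresh k R v
    ∈-fresh⁻ {R = zero} (here refl) = done
    ∈-fresh⁻ {R = suc R} v∈ = next (∈-pending⁻ v∈)

    ∈-pending⁻ : ∀ {k q c R v} → v ∈ pending k q c R → Pending k q c R v
    ∈-pending⁻ {k} {q} {c} {R} v∈ with ∈-++⁻ (map (k ∷_) (fresh c R)) v∈
    ... | inj₁ v∈placed with ∈-map⁻ (k ∷_) v∈placed
    ...   | _ , w∈ , refl = placeMin (∈-fresh⁻ w∈)
    ∈-pending⁻ {k} {q} {c} {R} v∈ | inj₂ v∈deferred with ∈-map⁻ (c ∷_) v∈deferred
    ...   | _ , w∈ , refl = ∈-deferred⁻ q R w∈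

    ∈-deferred⁻ : ∀ {k c w} q R → w ∈ deferred k q c R → Pending k q c R (c ∷ w)
    ∈-deferred⁻ (suc q) (suc R) w∈ = defer (∈-pending⁻ w∈)
    ∈-deferred⁻ zero _ ()
    ∈-deferred⁻ (suc q) zero ()

  mutual
    ∈-fresh⁺ : ∀ {k R v} → Fresh k R v → v ∈ fresh k R
    ∈-fresh⁺ done = here refl
    ∈-fresh⁺ (next pend) = ∈-pending⁺ pend

    ∈-pending⁺ : ∀ {k q c R v} → Pending k q c R v → v ∈ pending k q c R
    ∈-pending⁺ (placeMin fr) = ∈-++⁺ˡ (∈-map⁺ _ (∈-fresh⁺ fr))
    ∈-pending⁺ {k} {c = c} {R = suc R} (defer pend) =
      ∈-++⁺ʳ (map (k ∷_) (fresh c (suc R))) (∈-map⁺ (c ∷_) (∈-pending⁺ pend))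

  mutual
    unique-fresh : ∀ k R → Unique (fresh k R)
    unique-fresh k zero = [] ∷ []
    unique-fresh k (suc R) = unique-pending k (budget k) (suc k) R ≤-refl

    unique-pending : ∀ k q c R → k < c → Unique (pending k q c R)
    unique-pending k q c R k<c = unique-branches (<⇒≢ k<c) (unique-fresh c R) (unique-deferred k q c R k<c)

    unique-deferred : ∀ k q c R → k < c → Unique (deferred k q c R)
    unique-deferred k (suc q) c (suc R) k<c = unique-pending k q (suc c) R (m<n⇒m<1+n k<c)
    unique-deferred k zero c R _ = []
    unique-deferred k (suc q) c zero _ = []

  open StepFibonacci p

  mutual
    length-fresh-off-spine : ∀ {k} R → s ≤ k → length (fresh k R) ≡ fib R
    length-fresh-off-spine zero _ = refl
    length-fresh-off-spine {k} (suc R) s≤k =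
      trans (cong (λ q → length (pending k q (suc k) R)) (budget-off-spine s≤k))
            (length-pending k p (suc k) R (m≤n⇒m≤1+n s≤k))

    length-pending : ∀ k q c R → s ≤ c → length (pending k q c R) ≡ fibSum q R
    length-pending k q c R s≤c = trans (length-branches k c (fresh c R) (deferred k q c R))
      (cong₂ _+_ (length-fresh-off-spine R s≤c) (length-deferred k q c R s≤c))

    length-deferred : ∀ k q c R → s ≤ c → length (deferred k q c R) ≡ fibSumTail q R
    length-deferred k (suc q) c (suc R) s≤c = length-pending k q (suc c) R (m≤n⇒m≤1+n s≤c)
    length-deferred k zero c R _ = refl
    length-deferred k (suc q) c zero _ = refl

  -- Each spine element below s forces one position, hence the shift by s ∸ k.
  length-fresh : ∀ k R → length (fresh k R) ≡ fib (R ∸ (s ∸ k))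
  length-fresh k R with s ≤? k
  ... | yes s≤k = trans (length-fresh-off-spine R s≤k) (cong (λ m → fib (R ∸ m)) (sym (m≤n⇒m∸n≡0 s≤k)))
  length-fresh k zero | no _ = cong fib (sym (0∸n≡0 (s ∸ k)))
  length-fresh k (suc R) | no s≰k = begin
    length (pending k (budget k) (suc k) R) ≡⟨ cong (λ q → length (pending k q (suc k) R)) (budget-on-spine k<s) ⟩
    length (pending k 0 (suc k) R)          ≡⟨ length-branches k (suc k) (fresh (suc k) R) [] ⟩
    length (fresh (suc k) R) + 0            ≡⟨ +-identityʳ _ ⟩
    length (fresh (suc k) R)                ≡⟨ length-fresh (suc k) R ⟩
    fib (R ∸ (p ∸ k))                       ≡⟨ cong (λ m → fib (suc R ∸ m)) (sym (+-∸-assoc 1 (s≤s⁻¹ k<s))) ⟩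
    fib (suc R ∸ (s ∸ k))                   ∎
    where
    open ≡-Reasoning
    k<s : k < s
    k<s = ≰⇒> s≰k

  mutual
    fresh-↭ : ∀ {k R v} → Fresh k R v → v ↭ interval k R
    fresh-↭ done = ↭-refl
    fresh-↭ (next pend) = pending-↭ pend

    pending-↭ : ∀ {k q c R v} → Pending k q c R v → v ↭ k ∷ interval c R
    pending-↭ (placeMin fr) = prep _ (fresh-↭ fr)
    pending-↭ {k} {c = c} (defer pend) = ↭-trans (prep c (pending-↭ pend)) (swap c k ↭-refl)

  pending-member : ∀ {k q c R v y} → Pending k q c R v → y ∈ v → y ≡ k ⊎ c ≤ y
  pending-member pend y∈v with ∈-resp-↭ (pending-↭ pend) y∈v
  ... | here y≡k = inj₁ y≡k
  ... | there y∈I = inj₂ (∈-interval⁻ y∈I)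

  module _ (n : ℕ) where
    open Comb s n

    window-closed : ∀ {k c} → Window k 0 c → 1 ≤ k → c ≤ n → k ≼ c
    window-closed (onSpine k<s) 1≤k k<n = spine 1≤k (⊓-glb k<s k<n) ◅ ε
    window-closed {k} {c} (offSpine _ _ c+0≡k+s) 1≤k c≤n =
      subst (k ≼_) (sym c≡k+s) (tooth 1≤k (subst (_≤ n) c≡k+s c≤n) ◅ ε)
      where
      c≡k+s : c ≡ k + s
      c≡k+s = trans (sym (+-identityʳ c)) c+0≡k+s

    window-open : ∀ {k q c} → Window k (suc q) c → ¬ k ≼ c
    window-open {q = q} {c} (offSpine s≤k k<c c+q≡k+s) k≼c with ≼-off-spine s≤k k≼c
    ... | inj₁ c≡k = <⇒≢ k<c (sym c≡k)
    ... | inj₂ k+s≤c = <⇒≱ (subst (c <_) c+q≡k+s (m<m+n c z<s)) k+s≤c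

    mutual
      fresh-respectsOrder : ∀ {k R v} → Fresh k R v → RespectsOrder v
      fresh-respectsOrder done = []
      fresh-respectsOrder {k} (next pend) = pending-respectsOrder (window-start k) pend

      pending-respectsOrder : ∀ {k q c R v} → Window k q c → Pending k q c R v → RespectsOrder v
      pending-respectsOrder win (placeMin fr) =
        All.tabulate (λ y∈w y≼k → <⇒≱ (window-< win)
                        (≤-trans (∈-interval⁻ (∈-resp-↭ (fresh-↭ fr) y∈w)) (≼⇒≤ y≼k)))
          ∷ fresh-respectsOrder fr
      pending-respectsOrder {c = c} win (defer {w = w} pend) =
        All.tabulate later-not-below ∷ pending-respectsOrder (window-step win) pend
        where
        later-not-below : ∀ {y} → y ∈ w → ¬ y ≼ c
        later-not-below y∈w y≼c with pending-member pend y∈w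
        ... | inj₁ refl = window-open win y≼c
        ... | inj₂ c<y = <⇒≱ c<y (≼⇒≤ y≼c)

    mutual
      fresh-noTwoBelow : ∀ {k R v} → Fresh k R v → NoTwoBelow v
      fresh-noTwoBelow done = []
      fresh-noTwoBelow {k} (next pend) = pending-noTwoBelow (window-start k) pend

      pending-noTwoBelow : ∀ {k q c R v} → Window k q c → Pending k q c R v → NoTwoBelow v
      pending-noTwoBelow win (placeMin fr) =
        (λ a∈w _ a≤k _ → ⊥-elim (<⇒≱ (window-< win) (≤-trans (∈-interval⁻ (∈-resp-↭ (fresh-↭ fr) a∈w)) a≤k)))
          ∷ fresh-noTwoBelow fr
      pending-noTwoBelow {k} {c = c} win (defer {w = w} pend) =
        (λ a∈w b∈w a≤c b≤c → trans (pending-min a∈w a≤c) (sym (pending-min b∈w b≤c)))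
          ∷ pending-noTwoBelow (window-step win) pend
        where
        pending-min : ∀ {y} → y ∈ w → y ≤ c → y ≡ k
        pending-min y∈w y≤c with pending-member pend y∈w
        ... | inj₁ y≡k = y≡k
        ... | inj₂ c<y = ⊥-elim (<⇒≱ c<y y≤c)

    mutual
      fresh-complete : ∀ {k R w} → 1 ≤ k → k + R ≡ suc n → w ↭ interval k R →
                       RespectsOrder w → NoTwoBelow w → Fresh k R w
      fresh-complete {R = zero} _ _ w↭ _ _ with refl ← ↭-empty-inv w↭ = done
      fresh-complete {k} {suc R} 1≤k k+R≡ w↭ ro ntb =
        next (pending-complete 1≤k (window-start k) (trans (sym (+-suc k R)) k+R≡) w↭ ro ntb)

      pending-complete : ∀ {k q c R w} → 1 ≤ k → Window k q c → c + R ≡ suc n → w ↭ k ∷ interval c R →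
                         RespectsOrder w → NoTwoBelow w → Pending k q c R w
      pending-complete {w = []} _ _ _ w↭ _ _ = ⊥-elim (¬x∷xs↭[] (↭-sym w↭))
      pending-complete {k} {w = x ∷ w} 1≤k win c+R≡ w↭ (x⋡w ∷ ro) (x-two ∷ ntb) with x ≟ k
      ... | yes refl = placeMin (fresh-complete (≤-trans (s≤s z≤n) (window-< win)) c+R≡ (drop-∷ w↭) ro ntb)
      ... | no x≢k = pending-complete-later 1≤k win c+R≡ w↭ (x⋡w ∷ ro) (x-two ∷ ntb)
                       (∈-tail (∈-resp-↭ (↭-sym w↭) (here refl)) (x≢k ∘ sym)) (∈-tail (∈-resp-↭ w↭ (here refl)) x≢k)

      -- If k is not placed first, the first entry must be c: otherwise both k and c
      -- follow a larger entry, and placing c first needs room in the window.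
      pending-complete-later : ∀ {k q c R x w} → 1 ≤ k → Window k q c → c + R ≡ suc n →
                               x ∷ w ↭ k ∷ interval c R → RespectsOrder (x ∷ w) → NoTwoBelow (x ∷ w) →
                               k ∈ w → x ∈ interval c R → Pending k q c R (x ∷ w)
      pending-complete-later {R = zero} _ _ _ _ _ _ _ ()
      pending-complete-later {k} {q} {c} {suc R} {x} {w} 1≤k win c+R≡ w↭ (x⋡w ∷ ro) (x-two ∷ ntb) k∈w x∈I
        with x ≟ c
      ... | no x≢c = ⊥-elim (<⇒≢ k<c (x-two k∈w c∈w (<⇒≤ (<-trans k<c c<x)) (<⇒≤ c<x)))
        where
        k<c : k < c
        k<c = window-< win
        c<x : c < x
        c<x = ∈-interval⁻ (∈-tail x∈I x≢c)
        c∈w : c ∈ w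
        c∈w = ∈-tail (∈-resp-↭ (↭-sym w↭) (there (here refl))) (x≢c ∘ sym)
      ... | yes refl with q
      ...   | zero = ⊥-elim (All.lookup x⋡w k∈w (window-closed win 1≤k c≤n))
        where
        c≤n : c ≤ n
        c≤n = subst (c ≤_) (suc-injective (trans (sym (+-suc c R)) c+R≡)) (m≤m+n c R)
      ...   | suc _ = defer (pending-complete 1≤k (window-step win) (trans (sym (+-suc c R)) c+R≡)
                              (drop-∷ (↭-trans w↭ (swap k c ↭-refl))) ro ntb)

    ∈-fresh⇔good : ∀ {v} → v ∈ fresh 1 n ⇔ Good s n v
    ∈-fresh⇔good {v} = mk⇔ (sound ∘ ∈-fresh⁻) (∈-fresh⁺ ∘ complete)
      where
      sound : Fresh 1 n v → Good s n v
      sound fr = (v↭ground , respectsOrder⇒positions (fresh-respectsOrder fr)) ,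
                 noTwoBelow⇒avoids (from-yes (1 <? 3)) (from-yes (2 <? 3)) uniq (fresh-noTwoBelow fr) ,
                 noTwoBelow⇒avoids (from-yes (2 <? 3)) (from-yes (1 <? 3)) uniq (fresh-noTwoBelow fr)
        where
        v↭ground : v ↭ ground n
        v↭ground = subst (v ↭_) (sym (ground≡interval n)) (fresh-↭ fr)
        uniq : Unique v
        uniq = Unique-resp-↭ (↭-sym v↭ground) (unique-ground n)

      complete : Good s n v → Fresh 1 n v
      complete ((v↭ground , ordered) , av312 , av321) =
        fresh-complete ≤-refl refl (subst (v ↭_) (ground≡interval n) v↭ground)
          (positions⇒respectsOrder ordered) (avoids⇒noTwoBelow av312 av321)

theorem16 : (s : ℕ) → 1 ≤ s →
    Σ (ℕ → ℕ) λ g →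
      (∀ n → HasCount (Good s n) (g n)) ×
      (∀ n → n ≤ s → g n ≡ 1) ×
      (∀ n → s < n → n < 2 * s → g n ≡ 2 ^ (n ∸ s)) ×
      (∀ n → 2 * s ≤ n → g n ≡ 2 * g (n ∸ 1) ∸ g (n ∸ s ∸ 1))
theorem16 (suc p) _ = g , count , small , (λ n _ → fib-shifted-pow n) , fib-shifted-recurrence
  where
  open StepFibonacci p
  open Arrangements p

  g : ℕ → ℕ
  g n = fib (n ∸ p)

  count : ∀ n → HasCount (Good (suc p) n) (g n)
  count n = fresh 1 n , unique-fresh 1 n , (λ _ → ∈-fresh⇔good n) , length-fresh 1 n

  small : ∀ n → n ≤ suc p → g n ≡ 1
  small n n≤s = trans (fib-shifted-pow n (≤-<-trans n≤s (m<m+n (suc p) z<s))) (cong (2 ^_) (m≤n⇒m∸n≡0 n≤s))
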